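{- Let $\mathfrak a\subseteq S=k[x_1,\dots,x_n]$ be a monomial ideal satisfying the strong $\gcd$-condition. Then there exists an acyclic matching $\mathcal M$ (a sequence of acyclic matchings, each on the Morse complex produced by the previous ones) on the Taylor resolution of $\mathfrak a$ such that every nonempty $I\subseteq\mathrm{MinGen}(\mathfrak a)$ with $I\notin\mathcal M$ satisfies $cl(I)=1$.
   Context: $\mathrm{MinGen}(\mathfrak a)$ is the minimal monomial generating set of $\mathfrak a$. For $I\subseteq\mathrm{MinGen}(\mathfrak a)$, $cl(I)$ is the number of classes of $I$ under the transitive closure of $m\sim m'\iff\gcd(m,m')\ne1$. $\mathfrak a$ satisfies the strong $\gcd$-condition if there is a linear order $\prec$ on $\mathrm{MinGen}(\mathfrak a)$ such that for any $m\prec n$ in $\mathrm{MinGen}(\mathfrak a)$ with $\gcd(m,n)=1$ there is $u\in\mathrm{MinGen}(\mathfrak a)$, $u\neq m,n$, with $m\prec u$ and $u\mid\mathrm{lcm}(m,n)$. Taylor resolution of $\mathfrak a$: free $S$-module with basis indexed by nonempty $I\subseteq\mathrm{MinGen}(\mathfrak a)=\{m_1,\dots,m_l\}$ (degree $|I|-1$), $\partial(I)=\sum_j(-1)^{j+1}\frac{m_I}{m_{I\setminus\{m_{i_j}\}}}(I\setminus\{m_{i_j}\})$, $m_I=\mathrm{lcm}(I)$, $I=\{m_{i_1},\dots,m_{i_r}\}$ with $i_1<\dots<i_r$. Acyclic matching (algebraic discrete Morse theory): in the directed graph on the basis with edges $c\to c'$ when the coefficient $[c:c']$ of $c'$ in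 $\partial c$ is nonzero, a set of edges such that every vertex lies in at most one, each matched coefficient is a central unit, and reversing the matched edges creates no directed cycle; the Morse complex is free on unmatched elements with differential given by weighted path sums, and is homotopy equivalent to the original. $I\in\mathcal M$ means $I$ lies in a matched edge. -}

module Defs where

open import Level using (Level; _⊔_) renaming (suc to lsuc)
open import Algebra.Bundles using (CommutativeRing)
open import Data.Nat as ℕ using (ℕ; zero; suc; _⊓_) renaming (_≤_ to _≤ℕ_; _+_ to _+ℕ_; _∸_ to _∸ℕ_)
import Data.Nat.Properties as ℕP
open import Data.Bool using (Bool; true; false; if_then_else_; _∧_)
open import Data.Fin using (Fin; zero; suc; _<_)
import Data.Fin.Properties as FinP
open import Data.Vec as Vec using (Vec; []; _∷_; zipWith; replicate; tabulate; lookup)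
import Data.Vec.Properties as VecP
open import Data.Vec.Relation.Binary.Pointwise.Inductive using (Pointwise)
open import Data.List as List using (List; []; _∷_; length; filter; foldr; concatMap; _++_)
open import Data.List.Membership.Propositional using (_∈_)
open import Data.List.Relation.Unary.Any using (Any)
open import Data.List.Relation.Unary.Unique.Propositional using (Unique)
open import Data.Product using (Σ; ∃; ∃-syntax; _×_; _,_; proj₁; proj₂)
open import Data.Sum using (_⊎_)
open import Data.Empty using (⊥)
open import Relation.Nullary using (¬_; Dec; yes; no; does)
open import Relation.Nullary.Decidable using (⌊_⌋; _×-dec_)
open import Relation.Binary.PropositionalEquality using (_≡_; _≢_)
open import Relation.Binary.Construct.Closure.Transitive using (TransClosure)
open import Relation.Binary.Construct.Closure.ReflexiveTransitive using (Star)

record Field (c ℓ : Level) : Set (lsuc (c ⊔ ℓ)) where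
  field
    commutativeRing : CommutativeRing c ℓ
  open CommutativeRing commutativeRing public
  field
    1≉0     : ¬ (1# ≈ 0#)
    inverse : ∀ x → ¬ (x ≈ 0#) → ∃[ y ] (x * y ≈ 1#)

Mono : ℕ → Set
Mono n = Vec ℕ n

_∣ₘ_ : ∀ {n} → Mono n → Mono n → Set
m ∣ₘ m' = Pointwise _≤ℕ_ m m'

gcdₘ : ∀ {n} → Mono n → Mono n → Mono n
gcdₘ = zipWith _⊓_

lcmₘ : ∀ {n} → Mono n → Mono n → Mono n
lcmₘ = zipWith ℕ._⊔_

oneₘ : ∀ {n} → Mono n
oneₘ = replicate _ 0

-- quotient m / m' (meaningful when m' ∣ m)
_/ₘ_ : ∀ {n} → Mono n → Mono n → Mono n
_/ₘ_ = zipWith _∸ℕ_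

_≟ₘ_ : ∀ {n} (m m' : Mono n) → Dec (m ≡ m')
_≟ₘ_ = VecP.≡-dec ℕP._≟_

-- A finite list of monomials g : Fin l → Mono n is the minimal monomial
-- generating set MinGen(𝔞) of the monomial ideal 𝔞 it generates iff no
-- generator divides a different one.  Every monomial ideal of S arises
-- this way (Dickson), so monomial ideals are given by their MinGen.

IsMinGen : ∀ {n l} → (Fin l → Mono n) → Set
IsMinGen g = ∀ i j → g i ∣ₘ g j → i ≡ j

StrongGcd : ∀ {n l} → (Fin l → Mono n) → Set₁
StrongGcd {n} {l} g =
  ∃[ _≺_ ] (IsStrictTotalOrder′ _≺_ ×
    (∀ m k → m ≺ k → gcdₘ (g m) (g k) ≡ oneₘ →
      ∃[ u ] (u ≢ m × u ≢ k × m ≺ u × g u ∣ₘ lcmₘ (g m) (g k))))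
  where
  open import Relation.Binary.Structures {A = Fin l} _≡_ using (IsStrictTotalOrder)
  IsStrictTotalOrder′ : (Fin l → Fin l → Set) → Set
  IsStrictTotalOrder′ R = IsStrictTotalOrder R

-- Subsets I ⊆ MinGen(𝔞), as characteristic vectors over Fin l.

Cell : ℕ → Set
Cell l = Vec Bool l

_∈ᶜ_ : ∀ {l} → Fin l → Cell l → Set
i ∈ᶜ I = lookup I i ≡ true

NonEmpty : ∀ {l} → Cell l → Set
NonEmpty I = ∃[ i ] (i ∈ᶜ I)

size : ∀ {l} → Cell l → ℕ
size [] = 0
size (true ∷ I) = suc (size I)
size (false ∷ I) = size I

_≟ᶜ_ : ∀ {l} (I J : Cell l) → Dec (I ≡ J)
_≟ᶜ_ = VecP.≡-dec Data.Bool._≟_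
  where import Data.Bool

allCells : ∀ l → List (Cell l)
allCells zero = [] ∷ []
allCells (suc l) = List.map (true ∷_) (allCells l) ++ List.map (false ∷_) (allCells l)

isNonEmpty : ∀ {l} → Cell l → Bool
isNonEmpty [] = false
isNonEmpty (true ∷ I) = true
isNonEmpty (false ∷ I) = isNonEmpty I

taylorCells : ∀ l → List (Cell l)
taylorCells l = filter (λ I → isNonEmpty I Data.Bool.≟ true) (allCells l)
  where import Data.Bool

lcmCell : ∀ {n l} → (Fin l → Mono n) → Cell l → Mono n
lcmCell {n} {l} g I = Vec.foldr (λ _ → Mono n) lcmₘ oneₘ
  (tabulate (λ i → if lookup I i then g i else oneₘ))

remove : ∀ {l} → Cell l → Fin l → Cell l
remove I i = I Vec.[ i ]≔ false

-- number of elements of I with index < i  (so m_i is the (pos+1)-th element)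
posIn : ∀ {l} → Cell l → Fin l → ℕ
posIn I i = List.length (filter (λ j → (j FinP.<? i) Relation.Nullary.Decidable.×-dec (lookup I j Data.Bool.≟ true))
                               (List.allFin _))
  where import Data.Bool

-- Polynomials over a field: finite lists of terms (coefficient, monomial),
-- compared by their coefficient functions.

module _ {c ℓ : Level} (K : Field c ℓ) where
  private module K = Field K

  Poly : ℕ → Set c
  Poly n = List (K.Carrier × Mono n)

  coeff : ∀ {n} → Poly n → Mono n → K.Carrier
  coeff [] μ = K.0#
  coeff ((a , ν) ∷ p) μ with ν ≟ₘ μ
  ... | yes _ = a K.+ coeff p μ
  ... | no  _ = coeff p μ

  _≈ₚ_ : ∀ {n} → Poly n → Poly n → Set ℓ
  p ≈ₚ q = ∀ μ → coeff p μ K.≈ coeff q μ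

  0ₚ : ∀ {n} → Poly n
  0ₚ = []

  1ₚ : ∀ {n} → Poly n
  1ₚ = (K.1# , oneₘ) ∷ []

  _+ₚ_ : ∀ {n} → Poly n → Poly n → Poly n
  _+ₚ_ = _++_

  -ₚ_ : ∀ {n} → Poly n → Poly n
  -ₚ_ = List.map (λ t → K.- proj₁ t , proj₂ t)

  _*ₚ_ : ∀ {n} → Poly n → Poly n → Poly n
  p *ₚ q = concatMap (λ s → List.map (λ t → (proj₁ s K.* proj₁ t) , zipWith _+ℕ_ (proj₂ s) (proj₂ t)) q) p

  monoₚ : ∀ {n} → Mono n → Poly n
  monoₚ μ = (K.1# , μ) ∷ []

  sumₚ : ∀ {n} → List (Poly n) → Poly n
  sumₚ = foldr _+ₚ_ 0ₚ

  signₚ : ∀ {n} → ℕ → Poly n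
  signₚ zero = 1ₚ
  signₚ (suc k) = -ₚ signₚ k

  -- Taylor resolution: coefficient [I : J] of J in ∂(I).
  -- ∂(I) = Σ_j (-1)^{j+1} (m_I / m_{I∖m_{i_j}}) (I ∖ m_{i_j}),
  -- the sign being (-1)^{posIn I i} for i = i_j; J must be nonempty.

  taylorD : ∀ {n l} → (Fin l → Mono n) → Cell l → Cell l → Poly n
  taylorD {n} {l} g I J = sumₚ (List.map term (List.allFin l))
    where
    term : Fin l → Poly n
    term i with lookup I i | remove I i ≟ᶜ J | isNonEmpty J
    ... | true | yes _ | true = signₚ (posIn I i) *ₚ monoₚ (lcmCell g I /ₘ lcmCell g J)
    ... | _    | _     | _    = 0ₚ

  -- A based complex: the list of current basis elements (cells, of
  -- homological degree size − 1) and the coefficients [c : c'].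

  record Based (n l : ℕ) : Set c where
    constructor based
    field
      cells : List (Cell l)
      D     : Cell l → Cell l → Poly n
  open Based public

  taylor : ∀ {n l} → (Fin l → Mono n) → Based n l
  taylor {l = l} g = based (taylorCells l) (taylorD g)

  -- A matched edge (y , x , u): y → x with u a (two-sided, S commutative)
  -- inverse of the coefficient [y : x].
  Matching : ℕ → ℕ → Set c
  Matching n l = List (Cell l × Cell l × Poly n)

  endpoints : ∀ {n l} → Matching n l → List (Cell l)
  endpoints = concatMap (λ e → proj₁ e ∷ proj₁ (proj₂ e) ∷ [])

  MatchedEdge : ∀ {n l} → Matching n l → Cell l → Cell l → Set c
  MatchedEdge M a b = Any (λ e → proj₁ e ≡ a × proj₁ (proj₂ e) ≡ b) M

  matchedEdge? : ∀ {n l} (M : Matching n l) a b → Dec (MatchedEdge M a b)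
  matchedEdge? M a b = Data.List.Relation.Unary.Any.any?
    (λ e → (proj₁ e ≟ᶜ a) ×-dec (proj₁ (proj₂ e) ≟ᶜ b)) M
    where import Data.List.Relation.Unary.Any

  EdgeM : ∀ {n l} → Based n l → Matching n l → Cell l → Cell l → Set (c ⊔ ℓ)
  EdgeM B M a b = a ∈ cells B × b ∈ cells B ×
    ((¬ (D B a b ≈ₚ 0ₚ) × ¬ MatchedEdge M a b) ⊎ MatchedEdge M b a)

  IsAcyclicMatching : ∀ {n l} → Based n l → Matching n l → Set (c ⊔ ℓ)
  IsAcyclicMatching B M =
    (∀ {y x u} → (y , x , u) ∈ M →
        y ∈ cells B × x ∈ cells B × (u *ₚ D B y x) ≈ₚ 1ₚ × (D B y x *ₚ u) ≈ₚ 1ₚ)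
    × Unique (endpoints M)
    × (∀ a → ¬ TransClosure (EdgeM B M) a a)

  -- weight of the edge a → b of G_M: [a : b] for an unmatched edge,
  -- -[b : a]^{-1} for a reversed matched edge
  weight : ∀ {n l} → Based n l → Matching n l → Cell l → Cell l → Poly n
  weight B M a b =
    (if does (matchedEdge? M a b) then 0ₚ else D B a b)
    +ₚ sumₚ (List.map (λ e → if does (proj₁ e ≟ᶜ b) ∧ does (proj₁ (proj₂ e) ≟ᶜ a)
                              then -ₚ proj₂ (proj₂ e) else 0ₚ) M)

  -- Γ f a c' : sum of weights of all paths in G_M of length ≤ f from a to c'
  Γ : ∀ {n l} → Based n l → Matching n l → ℕ → Cell l → Cell l → Poly n
  Γ B M zero a c' = if does (a ≟ᶜ c') then 1ₚ else 0ₚ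
  Γ B M (suc f) a c' = (if does (a ≟ᶜ c') then 1ₚ else 0ₚ)
    +ₚ sumₚ (List.map (λ b → weight B M a b *ₚ Γ B M f b c') (cells B))

  -- The Morse complex: unmatched cells, differential = path sums
  -- (acyclicity makes all paths have length < number of cells).
  morse : ∀ {n l} → Based n l → Matching n l → Based n l
  morse B M = based
    (filter (λ a → Data.List.Membership.DecPropositional._∉?_ _≟ᶜ_ a (endpoints M)) (cells B))
    (λ a b → if does (size a ℕ.≟ suc (size b)) then Γ B M (length (cells B)) a b else 0ₚ)
    where import Data.List.Membership.DecPropositional

  data MatchingSeq {n l} : Based n l → Based n l → Set (c ⊔ ℓ) where
    done : ∀ {B} → MatchingSeq B B
    step : ∀ {B B'} (M : Matching n l) → IsAcyclicMatching B M →
           MatchingSeq (morse B M) B' → MatchingSeq B B'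

-- cl(I) = 1 : the relation m ∼ m' ⇔ gcd(m,m') ≠ 1 on I has exactly one
-- class (under its reflexive-transitive closure, an equivalence relation).

GcdRel : ∀ {n l} → (Fin l → Mono n) → Cell l → Fin l → Fin l → Set
GcdRel g I i j = i ∈ᶜ I × j ∈ᶜ I × gcdₘ (g i) (g j) ≢ oneₘ

ClOne : ∀ {n l} → (Fin l → Mono n) → Cell l → Set
ClOne g I = NonEmpty I × (∀ i j → i ∈ᶜ I → j ∈ᶜ I → Star (GcdRel g I) i j)

{-# OPTIONS --safe #-}
-- Fix the order ≺ of the strong gcd-condition. For a nonempty I ⊆ MinGen(𝔞) let i be its
-- ≺-least element (the anchor), and call u a candidate of I if i ≺ u, gcd(m_u, m_i) ≠ 1 and
-- m_u ∣ lcm(m_i, m_j) for some j ∈ I with gcd(m_j, m_i) = 1; the pivot of I is its candidate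
-- of least index. Adding or removing the pivot u changes neither the anchor nor the candidates
-- (u is not coprime to m_i, so it is never such a j) nor m_I, so a single matching
-- I ∖ {u} ↔ I ∪ {u} suffices, and its coefficients are ±1. It is acyclic because every edge
-- of its graph increases the lexicographic key (anchor, size of the lower cell of the pair,
-- pivot index, presence of the pivot). An unmatched I has no candidate; so if some j ∈ I had
-- gcd(m_j, m_i) = 1, the u provided by the strong gcd-condition for i ≺ j would be coprime
-- to m_i, whence m_u ∣ m_j and u = j by minimality, which is absurd. Thus every element of I
-- shares a variable with m_i, and cl(I) = 1.

module Submission where

open import Defs
open import Level using (Level; 0ℓ)
import Algebra.Properties.Ring as RingProperties
open import Data.Bool as Bool using (Bool; true; false)
open import Data.Fin as Fin using (Fin; zero; suc; toℕ)
import Data.Fin.Properties as FinP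
open import Data.List as List using (List; []; _∷_; allFin; concatMap; filter)
import Data.List.Membership.DecPropositional as DecMembership
open import Data.List.Membership.Propositional using (_∈_; _∉_; find; lose)
import Data.List.Membership.Propositional.Properties as ∈P
import Data.List.Properties as ListP
open import Data.List.Relation.Unary.All as All using (All; []; _∷_)
open import Data.List.Relation.Unary.AllPairs using ([]; _∷_)
open import Data.List.Relation.Unary.Any using (here; there)
import Data.List.Relation.Unary.Any.Properties as AnyP
open import Data.List.Relation.Unary.Unique.Propositional using (Unique)
import Data.List.Relation.Unary.Unique.Propositional.Properties as UniqueP
open import Data.Maybe as Maybe using (Maybe; just; nothing; maybe; _>>=_)
import Data.Maybe.Properties as MaybeP
open import Data.Nat as ℕ using (ℕ; zero; suc; z≤n; s≤s; _+_; _∸_; _⊓_; _⊔_)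
import Data.Nat.Properties as ℕP
open import Data.Product using (∃-syntax; _×_; _,_; proj₁; proj₂)
open import Data.Product.Relation.Binary.Lex.Strict using (×-Lex; ×-isStrictPartialOrder)
open import Data.Product.Relation.Binary.Pointwise.NonDependent using (Pointwise)
open import Data.Sum using (_⊎_; inj₁; inj₂)
open import Data.Vec using ([]; _∷_; lookup; zipWith; _[_]≔_)
import Data.Vec.Properties as VecP
open import Data.Vec.Relation.Binary.Pointwise.Inductive as VecPointwise using ([]; _∷_)
open import Function using (_∘_; flip)
open import Relation.Binary using (Rel; tri<; tri≈; tri>)
import Relation.Binary.Construct.Add.Infimum.Strict as AddInfimum
open import Relation.Binary.Construct.Closure.ReflexiveTransitive using (Star; ε; _◅_; _◅◅_)
open import Relation.Binary.Construct.Closure.Transitive using (TransClosure; [_]; _∷_)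
import Relation.Binary.Construct.Flip.EqAndOrd as Flip
import Relation.Binary.Construct.StrictToNonStrict as StrictToNonStrict
open import Relation.Binary.PropositionalEquality
import Relation.Binary.Reasoning.Setoid as SetoidReasoning
open import Relation.Binary.Structures using (IsStrictTotalOrder; IsStrictPartialOrder)
open import Relation.Nullary using (¬_; Dec; yes; no; contradiction)
open import Relation.Nullary.Decidable as Dec using (_×-dec_; _→-dec_; ¬?)
open import Relation.Unary using (Pred; Decidable)

private variable
  a b p ℓ ℓ′ : Level

least : ∀ {l} {P : Pred (Fin l) p} → Decidable P → Maybe (Fin l)
least {l = zero}  P? = nothing
least {l = suc l} P? with P? zero
... | yes _ = just zero
... | no  _ = Maybe.map suc (least (P? ∘ suc))

least-sound : ∀ {l} {P : Pred (Fin l) p} (P? : Decidable P) {u} → least P? ≡ just u → P u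
least-sound {l = suc l} P? eq with P? zero
least-sound P? refl | yes P0 = P0
... | no _ with least (P? ∘ suc) in eq′
least-sound P? refl | no _ | just u = least-sound (P? ∘ suc) eq′

least-complete : ∀ {l} {P : Pred (Fin l) p} (P? : Decidable P) {u} → P u →
                 ∃[ v ] least P? ≡ just v
least-complete {l = suc l} P? {u} Pu with P? zero
... | yes _   = zero , refl
... | no  ¬P0 with u
...   | zero  = contradiction Pu ¬P0
...   | suc u with least-complete (P? ∘ suc) Pu
...     | v , eq = suc v , cong (Maybe.map suc) eq

least-cong : ∀ {l} {P Q : Pred (Fin l) p} (P? : Decidable P) (Q? : Decidable Q) →
             (∀ x → P x → Q x) → (∀ x → Q x → P x) → least P? ≡ least Q?
least-cong {l = zero}  P? Q? P⇒Q Q⇒P = refl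
least-cong {l = suc l} P? Q? P⇒Q Q⇒P with P? zero | Q? zero
... | yes _   | yes _   = refl
... | yes P0  | no ¬Q0  = contradiction (P⇒Q zero P0) ¬Q0
... | no ¬P0  | yes Q0  = contradiction (Q⇒P zero Q0) ¬P0
... | no _    | no _    =
  cong (Maybe.map suc) (least-cong (P? ∘ suc) (Q? ∘ suc) (P⇒Q ∘ suc) (Q⇒P ∘ suc))

rankOf : ∀ {l} → Maybe (Fin l) → ℕ
rankOf {l} = maybe toℕ l

rankOf-map-suc : ∀ {l} (m : Maybe (Fin l)) → rankOf (Maybe.map suc m) ≡ suc (rankOf m)
rankOf-map-suc (just u) = refl
rankOf-map-suc nothing  = refl

least-rank-antimono : ∀ {l} {P Q : Pred (Fin l) p} (P? : Decidable P) (Q? : Decidable Q) →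
                      (∀ x → Q x → P x) → rankOf (least P?) ℕ.≤ rankOf (least Q?)
least-rank-antimono {l = zero}  P? Q? Q⇒P = ℕP.≤-refl
least-rank-antimono {l = suc l} P? Q? Q⇒P with P? zero | Q? zero
... | yes _  | _      = z≤n
... | no ¬P0 | yes Q0 = contradiction (Q⇒P zero Q0) ¬P0
... | no _   | no _
  rewrite rankOf-map-suc (least (P? ∘ suc)) | rankOf-map-suc (least (Q? ∘ suc))
  = s≤s (least-rank-antimono (P? ∘ suc) (Q? ∘ suc) (Q⇒P ∘ suc))

rankOf-injective : ∀ {l} (m : Maybe (Fin l)) {u} → rankOf m ≡ toℕ u → m ≡ just u
rankOf-injective (just v) eq = cong just (FinP.toℕ-injective eq)
rankOf-injective {l} nothing {u} eq =
  contradiction (subst (ℕ._< l) (sym eq) (FinP.toℕ<n u)) (ℕP.<-irrefl refl)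

m<n⇒1+2m<2n : ∀ {m n} → m ℕ.< n → suc (m + m) ℕ.< n + n
m<n⇒1+2m<2n {m} {n} m<n = subst (ℕ._≤ n + n) (cong suc (ℕP.+-suc m m)) (ℕP.+-mono-≤ m<n m<n)

module _ {A : Set a} {_<_ : Rel A ℓ} (<-sto : IsStrictTotalOrder _≡_ _<_)
         {P : Pred A p} (P? : Decidable P) where
  open IsStrictTotalOrder <-sto using (compare; <-respʳ-≈) renaming (trans to <-trans)
  open StrictToNonStrict _≡_ _<_ using (_≤_; <-≤-trans)

  none-or-minimal : ∀ xs → All (¬_ ∘ P) xs ⊎ ∃[ m ] (P m × All (λ x → P x → m ≤ x) xs)
  none-or-minimal [] = inj₁ []
  none-or-minimal (x ∷ xs) with P? x | none-or-minimal xs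
  ... | no ¬Px | inj₁ none          = inj₁ (¬Px ∷ none)
  ... | no ¬Px | inj₂ (m , Pm , m≤) = inj₂ (m , Pm , (λ Px → contradiction Px ¬Px) ∷ m≤)
  ... | yes Px | inj₁ none          =
    inj₂ (x , Px , (λ _ → inj₂ refl) ∷ All.map (λ ¬Py Py → contradiction Py ¬Py) none)
  ... | yes Px | inj₂ (m , Pm , m≤) with compare x m
  ...   | tri< x<m _ _  = inj₂ (x , Px , (λ _ → inj₂ refl) ∷ All.map x≤ m≤)
    where
    x≤ : ∀ {y} → (P y → m ≤ y) → P y → x ≤ y
    x≤ m≤y Py = inj₁ (<-≤-trans <-trans <-respʳ-≈ x<m (m≤y Py))
  ...   | tri≈ _ refl _ = inj₂ (m , Pm , (λ _ → inj₂ refl) ∷ m≤)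
  ...   | tri> _ _ m<x  = inj₂ (m , Pm , (λ _ → inj₁ m<x) ∷ m≤)

module _ {ℓ₁} {A : Set a} {B : Set b} {_≈_ : Rel B ℓ₁} {_<_ : Rel B ℓ}
         (<-spo : IsStrictPartialOrder _≈_ _<_) {E : Rel A ℓ′}
         (key : A → B) (increasing : ∀ {x y} → E x y → key x < key y) where
  open IsStrictPartialOrder <-spo using (irrefl; module Eq) renaming (trans to <-trans)

  acyclic-if-key-increasing : ∀ x → ¬ TransClosure E x x
  acyclic-if-key-increasing x cycle = irrefl Eq.refl (increasing⁺ cycle)
    where
    increasing⁺ : ∀ {x y} → TransClosure E x y → key x < key y
    increasing⁺ [ e ]    = increasing e
    increasing⁺ (e ∷ es) = <-trans (increasing e) (increasing⁺ es)

module _ {A : Set a} {B : Set b} (f : A → List B) where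

  concatMap-≡[] : ∀ xs → (∀ {x} → x ∈ xs → f x ≡ []) → concatMap f xs ≡ []
  concatMap-≡[] []       _    = refl
  concatMap-≡[] (x ∷ xs) f≡[] rewrite f≡[] (here refl) = concatMap-≡[] xs (f≡[] ∘ there)

  concatMap-≡-single : ∀ {u} xs → Unique xs → u ∈ xs → (∀ {x} → x ≢ u → f x ≡ []) →
                       concatMap f xs ≡ f u
  concatMap-≡-single (x ∷ xs) (x∉xs ∷ _) (here refl) f≡[] =
    trans (cong (f x List.++_) (concatMap-≡[] xs λ {x′} x′∈ →
                                  f≡[] {x′} λ { refl → All.lookup x∉xs x′∈ refl }))
          (ListP.++-identityʳ (f x))
  concatMap-≡-single (x ∷ xs) (x∉xs ∷ xs!) (there u∈xs) f≡[]
    rewrite f≡[] {x} (λ { refl → All.lookup x∉xs u∈xs refl }) = concatMap-≡-single xs xs! u∈xs f≡[]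

insert : ∀ {l} → Cell l → Fin l → Cell l
insert I i = I [ i ]≔ true

∈ᶜ-update⁺ : ∀ {l} (I : Cell l) {i j} x → j ≢ i → j ∈ᶜ I → j ∈ᶜ (I [ i ]≔ x)
∈ᶜ-update⁺ I x j≢i j∈I = trans (VecP.lookup∘update′ j≢i I x) j∈I

∈ᶜ-update⁻ : ∀ {l} (I : Cell l) {i j} x → j ≢ i → j ∈ᶜ (I [ i ]≔ x) → j ∈ᶜ I
∈ᶜ-update⁻ I x j≢i j∈ = trans (sym (VecP.lookup∘update′ j≢i I x)) j∈

∈ᶜ-insert : ∀ {l} (I : Cell l) i → i ∈ᶜ insert I i
∈ᶜ-insert I i = VecP.lookup∘update i I true

∉ᶜ-remove : ∀ {l} (I : Cell l) i → ¬ i ∈ᶜ remove I i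
∉ᶜ-remove I i i∈ = contradiction (trans (sym i∈) (VecP.lookup∘update i I false)) λ ()

∈ᶜ-remove⁻ : ∀ {l} (I : Cell l) {i j} → j ∈ᶜ remove I i → j ∈ᶜ I
∈ᶜ-remove⁻ I {i} {j} j∈ with j Fin.≟ i
... | yes refl = contradiction j∈ (∉ᶜ-remove I i)
... | no j≢i   = ∈ᶜ-update⁻ I false j≢i j∈

remove-insert : ∀ {l} (I : Cell l) {u} → lookup I u ≡ false → remove (insert I u) u ≡ I
remove-insert I {u} u∉I =
  trans (VecP.[]≔-idempotent I u) (subst (λ x → I [ u ]≔ x ≡ I) u∉I (VecP.[]≔-lookup I u))

insert-remove : ∀ {l} (I : Cell l) {u} → u ∈ᶜ I → insert (remove I u) u ≡ I
insert-remove I {u} u∈I =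
  trans (VecP.[]≔-idempotent I u) (subst (λ x → I [ u ]≔ x ≡ I) u∈I (VecP.[]≔-lookup I u))

size-remove : ∀ {l} (I : Cell l) {i} → i ∈ᶜ I → size I ≡ suc (size (remove I i))
size-remove (true  ∷ I) {zero}  _   = refl
size-remove (true  ∷ I) {suc i} i∈I = cong suc (size-remove I i∈I)
size-remove (false ∷ I) {suc i} i∈I = size-remove I i∈I

size-remove-< : ∀ {l} (I : Cell l) {i} → i ∈ᶜ I → size (remove I i) ℕ.< size I
size-remove-< I i∈I = ℕP.≤-reflexive (sym (size-remove I i∈I))

∈ᶜ⇒isNonEmpty : ∀ {l} (I : Cell l) {i} → i ∈ᶜ I → isNonEmpty I ≡ true
∈ᶜ⇒isNonEmpty (true  ∷ I) _               = refl
∈ᶜ⇒isNonEmpty (false ∷ I) {suc i} i∈I = ∈ᶜ⇒isNonEmpty I i∈I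

isNonEmpty⇒NonEmpty : ∀ {l} (I : Cell l) → isNonEmpty I ≡ true → NonEmpty I
isNonEmpty⇒NonEmpty (true  ∷ I) _ = zero , refl
isNonEmpty⇒NonEmpty (false ∷ I) ne with isNonEmpty⇒NonEmpty I ne
... | i , i∈I = suc i , i∈I

∈-allCells : ∀ {l} (I : Cell l) → I ∈ allCells l
∈-allCells []          = here refl
∈-allCells (true  ∷ I) = ∈P.∈-++⁺ˡ (∈P.∈-map⁺ (true ∷_) (∈-allCells I))
∈-allCells (false ∷ I) = ∈P.∈-++⁺ʳ _ (∈P.∈-map⁺ (false ∷_) (∈-allCells I))

allCells-unique : ∀ l → Unique (allCells l)
allCells-unique zero    = All.[] ∷ []
allCells-unique (suc l) = UniqueP.++⁺ (UniqueP.map⁺ VecP.∷-injectiveʳ (allCells-unique l))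
                                      (UniqueP.map⁺ VecP.∷-injectiveʳ (allCells-unique l)) disjoint
  where
  disjoint : ∀ {I} → ¬ (I ∈ List.map (true ∷_) (allCells l) × I ∈ List.map (false ∷_) (allCells l))
  disjoint (p , q) with ∈P.∈-map⁻ (true ∷_) p | ∈P.∈-map⁻ (false ∷_) q
  ... | _ , _ , refl | _ , _ , ()

nonEmpty? : ∀ {l} (I : Cell l) → Dec (isNonEmpty I ≡ true)
nonEmpty? I = isNonEmpty I Bool.≟ true

∈-taylorCells⁺ : ∀ {l} {I : Cell l} → isNonEmpty I ≡ true → I ∈ taylorCells l
∈-taylorCells⁺ {I = I} ne = ∈P.∈-filter⁺ nonEmpty? (∈-allCells I) ne

∈-taylorCells⁻ : ∀ {l} {I : Cell l} → I ∈ taylorCells l → isNonEmpty I ≡ true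
∈-taylorCells⁻ {l} I∈ = proj₂ (∈P.∈-filter⁻ nonEmpty? {xs = allCells l} I∈)

∈-taylorCells⇒NonEmpty : ∀ {l} {I : Cell l} → I ∈ taylorCells l → NonEmpty I
∈-taylorCells⇒NonEmpty {I = I} I∈ = isNonEmpty⇒NonEmpty I (∈-taylorCells⁻ I∈)

taylorCells-unique : ∀ l → Unique (taylorCells l)
taylorCells-unique l = UniqueP.filter⁺ nonEmpty? (allCells-unique l)

∣ₘ-trans : ∀ {n} {m m′ m″ : Mono n} → m ∣ₘ m′ → m′ ∣ₘ m″ → m ∣ₘ m″
∣ₘ-trans = VecPointwise.trans ℕP.≤-trans

∣ₘ-antisym : ∀ {n} {m m′ : Mono n} → m ∣ₘ m′ → m′ ∣ₘ m → m ≡ m′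
∣ₘ-antisym []       []       = refl
∣ₘ-antisym (p ∷ ps) (q ∷ qs) = cong₂ _∷_ (ℕP.≤-antisym p q) (∣ₘ-antisym ps qs)

oneₘ-∣ : ∀ {n} (m : Mono n) → oneₘ ∣ₘ m
oneₘ-∣ []      = []
oneₘ-∣ (_ ∷ m) = z≤n ∷ oneₘ-∣ m

lcmₘ-upperˡ : ∀ {n} (m m′ : Mono n) → m ∣ₘ lcmₘ m m′
lcmₘ-upperˡ []      []        = []
lcmₘ-upperˡ (x ∷ m) (y ∷ m′) = ℕP.m≤m⊔n x y ∷ lcmₘ-upperˡ m m′

lcmₘ-upperʳ : ∀ {n} (m m′ : Mono n) → m′ ∣ₘ lcmₘ m m′
lcmₘ-upperʳ []      []        = []
lcmₘ-upperʳ (x ∷ m) (y ∷ m′) = ℕP.m≤n⊔m x y ∷ lcmₘ-upperʳ m m′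

lcmₘ-least : ∀ {n} {m m′ m″ : Mono n} → m ∣ₘ m″ → m′ ∣ₘ m″ → lcmₘ m m′ ∣ₘ m″
lcmₘ-least []       []       = []
lcmₘ-least (p ∷ ps) (q ∷ qs) = ℕP.⊔-lub p q ∷ lcmₘ-least ps qs

gcdₘ-comm : ∀ {n} (m m′ : Mono n) → gcdₘ m m′ ≡ gcdₘ m′ m
gcdₘ-comm []      []        = refl
gcdₘ-comm (x ∷ m) (y ∷ m′) = cong₂ _∷_ (ℕP.⊓-comm x y) (gcdₘ-comm m m′)

coprime-∣-lcmₘ : ∀ {n} (m m′ m″ : Mono n) → gcdₘ m m′ ≡ oneₘ → m ∣ₘ lcmₘ m′ m″ → m ∣ₘ m″
coprime-∣-lcmₘ []      []       []       _       []       = []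
coprime-∣-lcmₘ (x ∷ m) (y ∷ m′) (z ∷ m″) coprime (p ∷ ps) =
  coprime-≤ x y (VecP.∷-injectiveˡ coprime) p ∷ coprime-∣-lcmₘ m m′ m″ (VecP.∷-injectiveʳ coprime) ps
  where
  coprime-≤ : ∀ x y → x ⊓ y ≡ 0 → x ℕ.≤ y ⊔ z → x ℕ.≤ z
  coprime-≤ zero    _       _  _   = z≤n
  coprime-≤ (suc x) zero    _  x≤z = x≤z
  coprime-≤ (suc x) (suc y) ()

/ₘ-self : ∀ {n} (m : Mono n) → m /ₘ m ≡ oneₘ
/ₘ-self []      = refl
/ₘ-self (x ∷ m) = cong₂ _∷_ (ℕP.n∸n≡0 x) (/ₘ-self m)

oneₘ·oneₘ : ∀ {n} → zipWith _+_ oneₘ oneₘ ≡ oneₘ {n}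
oneₘ·oneₘ = VecP.zipWith-replicate _+_ 0 0

∈ᶜ⇒∣lcmCell : ∀ {n l} (g : Fin l → Mono n) (I : Cell l) {i} → i ∈ᶜ I → g i ∣ₘ lcmCell g I
∈ᶜ⇒∣lcmCell g (true ∷ I) {zero}  _   = lcmₘ-upperˡ (g zero) _
∈ᶜ⇒∣lcmCell g (_    ∷ I) {suc i} i∈I = ∣ₘ-trans (∈ᶜ⇒∣lcmCell (g ∘ suc) I i∈I) (lcmₘ-upperʳ _ _)

lcmCell-least : ∀ {n l} (g : Fin l → Mono n) (I : Cell l) {m} →
                (∀ i → i ∈ᶜ I → g i ∣ₘ m) → lcmCell g I ∣ₘ m
lcmCell-least g []          {m} _  = oneₘ-∣ m
lcmCell-least g (true  ∷ I) {m} ub = lcmₘ-least (ub zero refl) (lcmCell-least (g ∘ suc) I (ub ∘ suc))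
lcmCell-least g (false ∷ I) {m} ub = lcmₘ-least (oneₘ-∣ m) (lcmCell-least (g ∘ suc) I (ub ∘ suc))

lcmCell-insert : ∀ {n l} (g : Fin l → Mono n) (I : Cell l) {u} →
                 g u ∣ₘ lcmCell g I → lcmCell g (insert I u) ≡ lcmCell g I
lcmCell-insert g I {u} u∣ =
  ∣ₘ-antisym (lcmCell-least g (insert I u) ub)
             (lcmCell-least g I λ i i∈I → ∈ᶜ⇒∣lcmCell g (insert I u) (⊆insert i∈I))
  where
  ⊆insert : ∀ {i} → i ∈ᶜ I → i ∈ᶜ insert I u
  ⊆insert {i} i∈I with i Fin.≟ u
  ... | yes refl = ∈ᶜ-insert I u
  ... | no i≢u   = ∈ᶜ-update⁺ I true i≢u i∈I
  ub : ∀ i → i ∈ᶜ insert I u → g i ∣ₘ lcmCell g I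
  ub i i∈ with i Fin.≟ u
  ... | yes refl = u∣
  ... | no i≢u   = ∈ᶜ⇒∣lcmCell g I (∈ᶜ-update⁻ I true i≢u i∈)

-- The Taylor differential

module TaylorCoefficients {c ℓ : Level} (K : Field c ℓ) {n l : ℕ} (g : Fin l → Mono n) where
  private module K = Field K

  -- The summands of taylorD are where-bound in its definition; unification recovers them.
  private
    summandsOf : ∀ {D} {F : Fin l → Poly K n} → D ≡ sumₚ K (List.map F (allFin l)) →
                 Fin l → Poly K n
    summandsOf {F = F} _ = F

  summand : Cell l → Cell l → Fin l → Poly K n
  summand I J = summandsOf {D = taylorD K g I J} refl

  facetCoefficient : Cell l → Fin l → Poly K n
  facetCoefficient I i = _*ₚ_ K (signₚ K (posIn I i)) (monoₚ K (lcmCell g I /ₘ lcmCell g (remove I i)))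

  summand-vanishes : ∀ I J {i} → ¬ (i ∈ᶜ I × remove I i ≡ J) → summand I J i ≡ []
  summand-vanishes I J {i} ¬facet with lookup I i | remove I i ≟ᶜ J | isNonEmpty J
  ... | false | _         | _     = refl
  ... | true  | no _      | _     = refl
  ... | true  | yes _     | false = refl
  ... | true  | yes I∖i≡J | true  = contradiction (refl , I∖i≡J) ¬facet

  summand-facet : ∀ I {i} → i ∈ᶜ I → isNonEmpty (remove I i) ≡ true →
                  summand I (remove I i) i ≡ facetCoefficient I i
  summand-facet I {i} _ _ with lookup I i | remove I i ≟ᶜ remove I i | isNonEmpty (remove I i)
  ... | true | yes _ | true = refl
  ... | true | no ≢  | _    = contradiction refl ≢

  taylorD-support : ∀ I J → ¬ (_≈ₚ_ K (taylorD K g I J) (0ₚ K)) → ∃[ j ] (j ∈ᶜ I × remove I j ≡ J)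
  taylorD-support I J D≉0 with FinP.any? (λ j → (lookup I j Bool.≟ true) ×-dec (remove I j ≟ᶜ J))
  ... | yes facet = facet
  ... | no ¬facet = contradiction (λ μ → K.reflexive (cong (λ p → coeff K p μ) D≡[])) D≉0
    where
    D≡[] : taylorD K g I J ≡ []
    D≡[] = concatMap-≡[] (summand I J) (allFin l) λ {j} _ →
             summand-vanishes I J λ facet → ¬facet (j , facet)

  taylorD-facet : ∀ I {i} → i ∈ᶜ I → isNonEmpty (remove I i) ≡ true →
                  taylorD K g I (remove I i) ≡ facetCoefficient I i
  taylorD-facet I {i} i∈I ne =
    trans (concatMap-≡-single (summand I (remove I i)) (allFin l) (UniqueP.allFin⁺ l) (∈P.∈-allFin i)
                              others)
          (summand-facet I i∈I ne)
    where
    others : ∀ {j} → j ≢ i → summand I (remove I i) j ≡ []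
    others {j} j≢i = summand-vanishes I (remove I i) λ (j∈I , I∖j≡I∖i) →
      ∉ᶜ-remove I j (subst (j ∈ᶜ_) (sym I∖j≡I∖i) (∈ᶜ-update⁺ I false j≢i j∈I))

  sign : ℕ → K.Carrier
  sign zero    = K.1#
  sign (suc k) = K.- sign k

  signₚ≡ : ∀ k → signₚ K {n} k ≡ (sign k , oneₘ) ∷ []
  signₚ≡ zero    = refl
  signₚ≡ (suc k) rewrite signₚ≡ k = refl

  sign-square : ∀ k → sign k K.* sign k K.≈ K.1#
  sign-square zero    = K.*-identityˡ K.1#
  sign-square (suc k) = begin
    K.- s K.* K.- s       ≈⟨ -‿distribˡ-* s (K.- s) ⟨
    K.- (s K.* K.- s)     ≈⟨ K.-‿cong (-‿distribʳ-* s s) ⟨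
    K.- (K.- (s K.* s))   ≈⟨ -‿involutive (s K.* s) ⟩
    s K.* s               ≈⟨ sign-square k ⟩
    K.1#                  ∎
    where
    open RingProperties K.ring
    open SetoidReasoning K.setoid
    s : K.Carrier
    s = sign k

  singleton-cong : ∀ {x y} (μ : Mono n) → x K.≈ y → _≈ₚ_ K ((x , μ) ∷ []) ((y , μ) ∷ [])
  singleton-cong μ x≈y ν with μ ≟ₘ ν
  ... | yes _ = K.+-congʳ x≈y
  ... | no  _ = K.refl

  facet-unit : ∀ I {i J} → i ∈ᶜ I → remove I i ≡ J → isNonEmpty J ≡ true → lcmCell g J ≡ lcmCell g I →
               _≈ₚ_ K (_*ₚ_ K (signₚ K (posIn I i)) (taylorD K g I J)) (1ₚ K) ×
               _≈ₚ_ K (_*ₚ_ K (taylorD K g I J) (signₚ K (posIn I i))) (1ₚ K)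
  facet-unit I {i} i∈I refl ne same-lcm
    rewrite taylorD-facet I i∈I ne | same-lcm | /ₘ-self (lcmCell g I) | signₚ≡ (posIn I i)
          | oneₘ·oneₘ {n} | oneₘ·oneₘ {n}
    = singleton-cong oneₘ (K.trans (K.*-congˡ (K.*-identityʳ s)) (sign-square k))
    , singleton-cong oneₘ (K.trans (K.*-congʳ (K.*-identityʳ s)) (sign-square k))
    where
    k : ℕ
    k = posIn I i
    s : K.Carrier
    s = sign k

-- Matchings with prescribed upper cells

∈-morse⁻ : ∀ {c ℓ} (K : Field c ℓ) {n l} (B : Based K n l) (M : Matching K n l) {I} →
           I ∈ cells (morse K B M) → I ∈ cells B × I ∉ endpoints K M
∈-morse⁻ K B M = ∈P.∈-filter⁻ (λ I → DecMembership._∉?_ _≟ᶜ_ I (endpoints K M)) {xs = cells B}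

module MatchingOnLowerCells {c ℓ : Level} (K : Field c ℓ) {n l : ℕ}
                            (upper : Cell l → Cell l) (unit : Cell l → Poly K n) where

  matchingOn : List (Cell l) → Matching K n l
  matchingOn = List.map λ I → upper I , I , unit I

  ∈-endpoints⁻ : ∀ xs {J} → J ∈ endpoints K (matchingOn xs) → ∃[ I ] (I ∈ xs × (J ≡ upper I ⊎ J ≡ I))
  ∈-endpoints⁻ (I ∷ xs) (here J≡)         = I , here refl , inj₁ J≡
  ∈-endpoints⁻ (I ∷ xs) (there (here J≡)) = I , here refl , inj₂ J≡
  ∈-endpoints⁻ (I ∷ xs) (there (there J∈)) with ∈-endpoints⁻ xs J∈
  ... | I′ , I′∈ , J≡ = I′ , there I′∈ , J≡

  lower∈endpoints : ∀ {xs I} → I ∈ xs → I ∈ endpoints K (matchingOn xs)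
  lower∈endpoints (here refl) = there (here refl)
  lower∈endpoints (there I∈)  = there (there (lower∈endpoints I∈))

  upper∈endpoints : ∀ {xs I} → I ∈ xs → upper I ∈ endpoints K (matchingOn xs)
  upper∈endpoints (here refl) = here refl
  upper∈endpoints (there I∈)  = there (there (upper∈endpoints I∈))

  endpoints-unique : ∀ xs → Unique xs →
                     (∀ {I J} → I ∈ xs → J ∈ xs → upper I ≢ J) →
                     (∀ {I J} → I ∈ xs → J ∈ xs → upper I ≡ upper J → I ≡ J) →
                     Unique (endpoints K (matchingOn xs))
  endpoints-unique []       _            _      _         = []
  endpoints-unique (I ∷ xs) (I∉xs ∷ xs!) upper≢ upper-inj =
    All.tabulate upperI≢ ∷ All.tabulate I≢ ∷
    endpoints-unique xs xs! (λ p q → upper≢ (there p) (there q)) (λ p q → upper-inj (there p) (there q))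
    where
    upperI≢ : ∀ {J} → J ∈ I ∷ endpoints K (matchingOn xs) → upper I ≢ J
    upperI≢ (here refl) = upper≢ (here refl) (here refl)
    upperI≢ (there J∈) with ∈-endpoints⁻ xs J∈
    ... | I′ , I′∈ , inj₁ refl = All.lookup I∉xs I′∈ ∘ upper-inj (here refl) (there I′∈)
    ... | I′ , I′∈ , inj₂ refl = upper≢ (here refl) (there I′∈)
    I≢ : ∀ {J} → J ∈ endpoints K (matchingOn xs) → I ≢ J
    I≢ J∈ with ∈-endpoints⁻ xs J∈
    ... | I′ , I′∈ , inj₁ refl = upper≢ (there I′∈) (here refl) ∘ sym
    ... | I′ , I′∈ , inj₂ refl = All.lookup I∉xs I′∈

  matchedEdge⁻ : ∀ xs {x y} → MatchedEdge K (matchingOn xs) x y → ∃[ I ] (I ∈ xs × upper I ≡ x × I ≡ y)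
  matchedEdge⁻ xs e = find (AnyP.map⁻ e)

  matchedEdge⁺ : ∀ {xs I} → I ∈ xs → MatchedEdge K (matchingOn xs) (upper I) I
  matchedEdge⁺ I∈ = AnyP.map⁺ (lose I∈ (refl , refl))

-- The pivot matching

module PivotMatching {c ℓ : Level} (K : Field c ℓ) {n l : ℕ} (g : Fin l → Mono n)
                     {_≺_ : Fin l → Fin l → Set} (≺-sto : IsStrictTotalOrder _≡_ _≺_) where

  open IsStrictTotalOrder ≺-sto using (_<?_; irrefl) renaming (trans to ≺-trans)
  open StrictToNonStrict _≡_ _≺_ using () renaming (_≤_ to _≼_)
  open TaylorCoefficients K g using (taylorD-support; facet-unit)

  ≺⇒≢ : ∀ {i j} → i ≺ j → i ≢ j
  ≺⇒≢ i≺j refl = irrefl refl i≺j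

  IsLeast : Cell l → Fin l → Set
  IsLeast I i = i ∈ᶜ I × (∀ j → j ∈ᶜ I → i ≼ j)

  isLeast? : ∀ I → Decidable (IsLeast I)
  isLeast? I i = (lookup I i Bool.≟ true) ×-dec
    FinP.all? λ j → (lookup I j Bool.≟ true) →-dec StrictToNonStrict.decidable _≡_ _≺_ Fin._≟_ _<?_ i j

  IsLeast-unique : ∀ I {i i′} → IsLeast I i → IsLeast I i′ → i ≡ i′
  IsLeast-unique I (i∈ , i≼) (i′∈ , i′≼) =
    StrictToNonStrict.antisym _≡_ _≺_ isEquivalence ≺-trans irrefl (i≼ _ i′∈) (i′≼ _ i∈)

  IsLeast-exists : ∀ I → NonEmpty I → ∃[ i ] IsLeast I i
  IsLeast-exists I (j , j∈I) with none-or-minimal ≺-sto (λ j → lookup I j Bool.≟ true) (allFin l)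
  ... | inj₁ none           = contradiction j∈I (All.lookup none (∈P.∈-allFin j))
  ... | inj₂ (m , m∈I , m≼) = m , m∈I , λ k k∈I → All.lookup m≼ (∈P.∈-allFin k) k∈I

  IsLeast-update : ∀ I {i u} x → i ≺ u → IsLeast I i → IsLeast (I [ u ]≔ x) i
  IsLeast-update I {i} {u} x i≺u (i∈I , i≼) = ∈ᶜ-update⁺ I x (≺⇒≢ i≺u) i∈I , i≼′
    where
    i≼′ : ∀ j → j ∈ᶜ (I [ u ]≔ x) → i ≼ j
    i≼′ j j∈ with j Fin.≟ u
    ... | yes refl = inj₁ i≺u
    ... | no j≢u   = i≼ j (∈ᶜ-update⁻ I x j≢u j∈)

  IsLeast-remove : ∀ I {i j} → j ≢ i → IsLeast I i → IsLeast (remove I j) i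
  IsLeast-remove I j≢i (i∈I , i≼) = ∈ᶜ-update⁺ I false (j≢i ∘ sym) i∈I , λ k k∈ → i≼ k (∈ᶜ-remove⁻ I k∈)

  IsLeast-remove-least : ∀ I {i i′} → IsLeast I i → IsLeast (remove I i) i′ → i ≺ i′
  IsLeast-remove-least I {i} (_ , i≼) (i′∈ , _) with i≼ _ (∈ᶜ-remove⁻ I i′∈)
  ... | inj₁ i≺i′ = i≺i′
  ... | inj₂ refl = contradiction i′∈ (∉ᶜ-remove I i)

  anchor : Cell l → Maybe (Fin l)
  anchor I = least (isLeast? I)

  anchor-sound : ∀ I {i} → anchor I ≡ just i → IsLeast I i
  anchor-sound I = least-sound (isLeast? I)

  anchor-complete : ∀ I {i} → IsLeast I i → anchor I ≡ just i
  anchor-complete I i-least with least-complete (isLeast? I) i-least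
  ... | i′ , eq = trans eq (cong just (IsLeast-unique I (anchor-sound I eq) i-least))

  anchor-update : ∀ I {i u} x → anchor I ≡ just i → i ≺ u → anchor (I [ u ]≔ x) ≡ just i
  anchor-update I {u = u} x anchorI i≺u =
    anchor-complete (I [ u ]≔ x) (IsLeast-update I x i≺u (anchor-sound I anchorI))

  Candidate : Cell l → Fin l → Fin l → Set
  Candidate I i u = i ≺ u × gcdₘ (g u) (g i) ≢ oneₘ ×
                    ∃[ j ] (j ∈ᶜ I × gcdₘ (g j) (g i) ≡ oneₘ × g u ∣ₘ lcmₘ (g i) (g j))

  candidate? : ∀ I i → Decidable (Candidate I i)
  candidate? I i u = (i <? u) ×-dec ¬? (gcdₘ (g u) (g i) ≟ₘ oneₘ) ×-dec
    FinP.any? λ j → (lookup I j Bool.≟ true) ×-dec (gcdₘ (g j) (g i) ≟ₘ oneₘ) ×-dec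
                    VecPointwise.decidable ℕP._≤?_ (g u) (lcmₘ (g i) (g j))

  Candidate-transfer : ∀ I J {i u} → (∀ j → gcdₘ (g j) (g i) ≡ oneₘ → j ∈ᶜ I → j ∈ᶜ J) →
                       Candidate I i u → Candidate J i u
  Candidate-transfer I J I⊆J (i≺u , linked , j , j∈I , coprime , u∣) =
    i≺u , linked , j , I⊆J j coprime j∈I , coprime , u∣

  pivot : Cell l → Maybe (Fin l)
  pivot I = anchor I >>= λ i → least (candidate? I i)

  pivot≡least : ∀ I {i} → anchor I ≡ just i → pivot I ≡ least (candidate? I i)
  pivot≡least I = cong (_>>= λ i → least (candidate? I i))

  pivot-spec : ∀ I {u} → pivot I ≡ just u → ∃[ i ] (anchor I ≡ just i × Candidate I i u)
  pivot-spec I {u} = spec (anchor I) refl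
    where
    spec : ∀ m → anchor I ≡ m → (m >>= λ i → least (candidate? I i)) ≡ just u →
           ∃[ i ] (anchor I ≡ just i × Candidate I i u)
    spec (just i) anchorI eq = i , anchorI , least-sound (candidate? I i) eq

  pivot-exists : ∀ I {i u} → anchor I ≡ just i → Candidate I i u → ∃[ p ] pivot I ≡ just p
  pivot-exists I {i} anchorI cand with least-complete (candidate? I i) cand
  ... | p , eq = p , trans (pivot≡least I anchorI) eq

  pivot-cong : ∀ I J {i} → anchor I ≡ just i → anchor J ≡ just i →
               (∀ w → Candidate I i w → Candidate J i w) → (∀ w → Candidate J i w → Candidate I i w) →
               pivot I ≡ pivot J
  pivot-cong I J {i} anchorI anchorJ I⇒J J⇒I = begin
    pivot I                 ≡⟨ pivot≡least I anchorI ⟩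
    least (candidate? I i)  ≡⟨ least-cong (candidate? I i) (candidate? J i) I⇒J J⇒I ⟩
    least (candidate? J i)  ≡⟨ pivot≡least J anchorJ ⟨
    pivot J                 ∎
    where open ≡-Reasoning

  rank : Cell l → ℕ
  rank I = rankOf (pivot I)

  rank-antimono : ∀ I J {i} → anchor I ≡ just i → anchor J ≡ just i →
                  (∀ w → Candidate J i w → Candidate I i w) → rank I ℕ.≤ rank J
  rank-antimono I J {i} anchorI anchorJ J⇒I rewrite pivot≡least I anchorI | pivot≡least J anchorJ =
    least-rank-antimono (candidate? I i) (candidate? J i) J⇒I

  pivot-update : ∀ I {u} x → pivot I ≡ just u → pivot (I [ u ]≔ x) ≡ just u
  pivot-update I {u} x pivotI with pivot-spec I pivotI
  ... | i , anchorI , i≺u , linked , _ =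
    trans (sym (pivot-cong I (I [ u ]≔ x) anchorI (anchor-update I x anchorI i≺u)
                  (λ _ → Candidate-transfer I (I [ u ]≔ x) λ j coprime → ∈ᶜ-update⁺ I x (≢u coprime))
                  (λ _ → Candidate-transfer (I [ u ]≔ x) I λ j coprime → ∈ᶜ-update⁻ I x (≢u coprime))))
          pivotI
    where
    ≢u : ∀ {j} → gcdₘ (g j) (g i) ≡ oneₘ → j ≢ u
    ≢u coprime refl = linked coprime

  IsLower : Cell l → Set
  IsLower I = ∃[ u ] (pivot I ≡ just u × lookup I u ≡ false)

  isLower? : Decidable IsLower
  isLower? I = decide (pivot I) refl
    where
    decide : ∀ m → pivot I ≡ m → Dec (IsLower I)
    decide nothing  pivotI = no λ (_ , pivotI′ , _) → contradiction (trans (sym pivotI) pivotI′) λ ()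
    decide (just u) pivotI = Dec.map′ (λ u∉I → u , pivotI , u∉I)
      (λ (u′ , pivotI′ , u′∉I) →
         subst (λ v → lookup I v ≡ false) (MaybeP.just-injective (trans (sym pivotI′) pivotI)) u′∉I)
      (lookup I u Bool.≟ false)

  lowerCells : List (Cell l)
  lowerCells = filter isLower? (taylorCells l)

  -- Junk values when I has no pivot; only lower cells are ever paired.
  upper : Cell l → Cell l
  upper I = maybe (insert I) I (pivot I)

  unit : Cell l → Poly K n
  unit I = maybe (λ u → signₚ K (posIn (insert I u) u)) (1ₚ K) (pivot I)

  open MatchingOnLowerCells K upper unit

  pivotMatching : Matching K n l
  pivotMatching = matchingOn lowerCells

  ∈-lowerCells⁻ : ∀ {I} → I ∈ lowerCells → I ∈ taylorCells l × IsLower I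
  ∈-lowerCells⁻ = ∈P.∈-filter⁻ isLower? {xs = taylorCells l}

  upper≡insert : ∀ I {u} → pivot I ≡ just u → upper I ≡ insert I u
  upper≡insert I = cong (maybe (insert I) I)

  unit≡sign : ∀ I {u} → pivot I ≡ just u → unit I ≡ signₚ K (posIn (insert I u) u)
  unit≡sign I = cong (maybe (λ u → signₚ K (posIn (insert I u) u)) (1ₚ K))

  pivot-upper : ∀ I {u} → pivot I ≡ just u → pivot (upper I) ≡ just u
  pivot-upper I pivotI = trans (cong pivot (upper≡insert I pivotI)) (pivot-update I true pivotI)

  pivot-∣-lcmCell : ∀ I {u} → pivot I ≡ just u → g u ∣ₘ lcmCell g I
  pivot-∣-lcmCell I pivotI with pivot-spec I pivotI
  ... | i , anchorI , _ , _ , j , j∈I , _ , u∣ =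
    ∣ₘ-trans u∣ (lcmₘ-least (∈ᶜ⇒∣lcmCell g I (proj₁ (anchor-sound I anchorI))) (∈ᶜ⇒∣lcmCell g I j∈I))

  removePivot-lower : ∀ I {u} → I ∈ taylorCells l → pivot I ≡ just u → u ∈ᶜ I →
                      remove I u ∈ lowerCells × upper (remove I u) ≡ I
  removePivot-lower I {u} I∈ pivotI u∈I with pivot-spec I pivotI
  ... | i , anchorI , i≺u , _ =
    ∈P.∈-filter⁺ isLower? (∈-taylorCells⁺ (∈ᶜ⇒isNonEmpty (remove I u) i∈I∖u))
                 (u , pivot-I∖u , VecP.lookup∘update u I false) ,
    trans (upper≡insert (remove I u) pivot-I∖u) (insert-remove I u∈I)
    where
    pivot-I∖u : pivot (remove I u) ≡ just u
    pivot-I∖u = pivot-update I false pivotI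
    i∈I∖u : i ∈ᶜ remove I u
    i∈I∖u = ∈ᶜ-update⁺ I false (≺⇒≢ i≺u) (proj₁ (anchor-sound I anchorI))

  pivot⇒matched : ∀ I {p} → I ∈ taylorCells l → pivot I ≡ just p → I ∈ endpoints K pivotMatching
  pivot⇒matched I {p} I∈ pivotI with lookup I p in p∈?
  ... | false = lower∈endpoints (∈P.∈-filter⁺ isLower? I∈ (p , pivotI , p∈?))
  ... | true with removePivot-lower I I∈ pivotI p∈?
  ...   | I∖p∈ , upper≡I = subst (_∈ endpoints K pivotMatching) upper≡I (upper∈endpoints I∖p∈)

  matchedPair-units : ∀ {I} → I ∈ lowerCells →
    upper I ∈ taylorCells l ×
    _≈ₚ_ K (_*ₚ_ K (unit I) (taylorD K g (upper I) I)) (1ₚ K) ×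
    _≈ₚ_ K (_*ₚ_ K (taylorD K g (upper I) I) (unit I)) (1ₚ K)
  matchedPair-units {I} I∈ with ∈-lowerCells⁻ I∈
  ... | I∈T , u , pivotI , u∉I rewrite upper≡insert I pivotI | unit≡sign I pivotI =
    ∈-taylorCells⁺ (∈ᶜ⇒isNonEmpty (insert I u) (∈ᶜ-insert I u)) ,
    facet-unit (insert I u) (∈ᶜ-insert I u) (remove-insert I u∉I) (∈-taylorCells⁻ I∈T)
               (sym (lcmCell-insert g I (pivot-∣-lcmCell I pivotI)))

  pivotMatching-units : ∀ {y x w} → (y , x , w) ∈ pivotMatching →
    y ∈ taylorCells l × x ∈ taylorCells l ×
    _≈ₚ_ K (_*ₚ_ K w (taylorD K g y x)) (1ₚ K) × _≈ₚ_ K (_*ₚ_ K (taylorD K g y x) w) (1ₚ K)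
  pivotMatching-units e∈ with ∈P.∈-map⁻ _ e∈
  ... | I , I∈ , refl with matchedPair-units I∈
  ...   | upper∈ , units = upper∈ , proj₁ (∈-lowerCells⁻ I∈) , units

  upper≢lower : ∀ {I J} → I ∈ lowerCells → J ∈ lowerCells → upper I ≢ J
  upper≢lower {I} {J} I∈ J∈ refl with ∈-lowerCells⁻ I∈ | ∈-lowerCells⁻ J∈
  ... | _ , u , pivotI , _ | _ , v , pivotJ , v∉J
    with refl ← MaybeP.just-injective (trans (sym (pivot-upper I pivotI)) pivotJ)
    = contradiction (trans (sym u∈upper) v∉J) λ ()
    where
    u∈upper : u ∈ᶜ upper I
    u∈upper = subst (u ∈ᶜ_) (sym (upper≡insert I pivotI)) (∈ᶜ-insert I u)

  upper-injective : ∀ {I J} → I ∈ lowerCells → J ∈ lowerCells → upper I ≡ upper J → I ≡ J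
  upper-injective {I} {J} I∈ J∈ upperI≡upperJ with ∈-lowerCells⁻ I∈ | ∈-lowerCells⁻ J∈
  ... | _ , u , pivotI , u∉I | _ , v , pivotJ , v∉J
    with refl ← MaybeP.just-injective (trans (sym (pivot-upper I pivotI))
                                             (trans (cong pivot upperI≡upperJ) (pivot-upper J pivotJ)))
    = begin
      I                      ≡⟨ remove-insert I u∉I ⟨
      remove (insert I u) u  ≡⟨ cong (λ X → remove X u) insertI≡insertJ ⟩
      remove (insert J u) u  ≡⟨ remove-insert J v∉J ⟩
      J                      ∎
    where
    open ≡-Reasoning
    insertI≡insertJ : insert I u ≡ insert J u
    insertI≡insertJ = trans (sym (upper≡insert I pivotI)) (trans upperI≡upperJ (upper≡insert J pivotJ))

  pivotMatching-unique : Unique (endpoints K pivotMatching)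
  pivotMatching-unique = endpoints-unique lowerCells (UniqueP.filter⁺ isLower? (taylorCells-unique l))
                                          upper≢lower upper-injective

  isUpper : Cell l → Bool
  isUpper X = maybe (lookup X) false (pivot X)

  isUpper⁺ : ∀ X {u} → pivot X ≡ just u → u ∈ᶜ X → isUpper X ≡ true
  isUpper⁺ X pivotX u∈X = trans (cong (maybe (lookup X) false) pivotX) u∈X

  upper-or-not : ∀ X → ∃[ u ] (pivot X ≡ just u × u ∈ᶜ X) ⊎ isUpper X ≡ false
  upper-or-not X = view (pivot X) refl
    where
    view : ∀ m → pivot X ≡ m → ∃[ u ] (pivot X ≡ just u × u ∈ᶜ X) ⊎ maybe (lookup X) false m ≡ false
    view nothing  _ = inj₂ refl
    view (just u) pivotX with lookup X u in u∈?
    ... | true  = inj₁ (u , pivotX , u∈?)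
    ... | false = inj₂ refl

  pairKeyOf : Bool → ℕ → ℕ → ℕ × ℕ
  pairKeyOf true  s r = s ∸ 1 , suc (r + r)
  pairKeyOf false s r = s , r + r

  -- Both cells of a matched pair share the first component; the second puts the upper
  -- cell just above the lower one.
  pairKey : Cell l → ℕ × ℕ
  pairKey X = pairKeyOf (isUpper X) (size X) (rank X)

  pairKey-upper : ∀ X {u} → pivot X ≡ just u → u ∈ᶜ X → pairKey X ≡ (size X ∸ 1 , suc (toℕ u + toℕ u))
  pairKey-upper X pivotX u∈X =
    cong₂ (λ b r → pairKeyOf b (size X) r) (isUpper⁺ X pivotX u∈X) (cong rankOf pivotX)

  pairKey-lower : ∀ X {u} → pivot X ≡ just u → lookup X u ≡ false → pairKey X ≡ (size X , toℕ u + toℕ u)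
  pairKey-lower X pivotX u∉X = cong₂ (λ b r → pairKeyOf b (size X) r)
    (trans (cong (maybe (lookup X) false) pivotX) u∉X) (cong rankOf pivotX)

  pairKey-notUpper : ∀ X → isUpper X ≡ false → pairKey X ≡ (size X , rank X + rank X)
  pairKey-notUpper X = cong λ b → pairKeyOf b (size X) (rank X)

  pairKey₁≤size : ∀ X → proj₁ (pairKey X) ℕ.≤ size X
  pairKey₁≤size X with isUpper X
  ... | true  = ℕP.m∸n≤m (size X) 1
  ... | false = ℕP.≤-refl

  _<ₚ_ : Rel (ℕ × ℕ) 0ℓ
  _<ₚ_ = ×-Lex _≡_ (flip ℕ._<_) ℕ._<_

  open AddInfimum _≺_ using (_<₋_; [_]; <₋-isStrictPartialOrder-≡)

  _⊏_ : Rel (Maybe (Fin l) × ℕ × ℕ) 0ℓ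
  _⊏_ = ×-Lex _≡_ _<₋_ _<ₚ_

  ⊏-isStrictPartialOrder : IsStrictPartialOrder (Pointwise _≡_ (Pointwise _≡_ _≡_)) _⊏_
  ⊏-isStrictPartialOrder =
    ×-isStrictPartialOrder
      (<₋-isStrictPartialOrder-≡ (IsStrictTotalOrder.isStrictPartialOrder ≺-sto))
      (×-isStrictPartialOrder (Flip.isStrictPartialOrder ℕP.<-isStrictPartialOrder)
                              ℕP.<-isStrictPartialOrder)

  key : Cell l → Maybe (Fin l) × ℕ × ℕ
  key X = anchor X , pairKey X

  up-edge-increases : ∀ {I} → I ∈ lowerCells → key I ⊏ key (upper I)
  up-edge-increases {I} I∈ with ∈-lowerCells⁻ I∈
  ... | _ , u , pivotI , u∉I with pivot-spec I pivotI
  ...   | i , anchorI , i≺u , _ =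
    inj₂ (sym anchor-upper , subst₂ _<ₚ_ (sym key-I) (sym key-upper) (inj₂ (sym size-upper , ℕP.n<1+n _)))
    where
    upper≡ : upper I ≡ insert I u
    upper≡ = upper≡insert I pivotI
    u∈upper : u ∈ᶜ upper I
    u∈upper = subst (u ∈ᶜ_) (sym upper≡) (∈ᶜ-insert I u)
    key-I : pairKey I ≡ (size I , toℕ u + toℕ u)
    key-I = pairKey-lower I pivotI u∉I
    key-upper : pairKey (upper I) ≡ (size (upper I) ∸ 1 , suc (toℕ u + toℕ u))
    key-upper = pairKey-upper (upper I) (pivot-upper I pivotI) u∈upper
    anchor-upper : anchor (upper I) ≡ anchor I
    anchor-upper = trans (cong anchor upper≡) (trans (anchor-update I true anchorI i≺u) (sym anchorI))
    size-upper : size (upper I) ∸ 1 ≡ size I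
    size-upper = trans (cong (_∸ 1) (size-remove (upper I) u∈upper))
                       (cong size (trans (cong (λ X → remove X u) upper≡) (remove-insert I u∉I)))

  removed-from-upper-increases : ∀ a {i j u} → anchor a ≡ just i → anchor (remove a j) ≡ just i →
    j ∈ᶜ a → j ≢ u → pivot a ≡ just u → u ∈ᶜ a → pairKey a <ₚ pairKey (remove a j)
  removed-from-upper-increases a {i} {j} {u} anchor-a anchor-b j∈a j≢u pivot-a u∈a
    with upper-or-not (remove a j)
  ... | inj₁ (w , pivot-b , w∈b) =
    subst₂ _<ₚ_ (sym (pairKey-upper a pivot-a u∈a)) (sym (pairKey-upper (remove a j) pivot-b w∈b))
      (inj₁ (subst₂ ℕ._<_ (sym (cong (_∸ 1) (size-remove (remove a j) w∈b)))
                          (sym (cong (_∸ 1) (size-remove a j∈a)))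
                          (size-remove-< (remove a j) w∈b)))
  ... | inj₂ notUpper-b =
    subst₂ _<ₚ_ (sym (pairKey-upper a pivot-a u∈a)) (sym (pairKey-notUpper (remove a j) notUpper-b))
      (inj₂ (cong (_∸ 1) (size-remove a j∈a) , m<n⇒1+2m<2n (ℕP.≤∧≢⇒< u≤rank-b u≢rank-b)))
    where
    u∈b : u ∈ᶜ remove a j
    u∈b = ∈ᶜ-update⁺ a false (j≢u ∘ sym) u∈a
    u≤rank-b : toℕ u ℕ.≤ rank (remove a j)
    u≤rank-b = subst (ℕ._≤ rank (remove a j)) (cong rankOf pivot-a)
      (rank-antimono a (remove a j) anchor-a anchor-b λ _ →
         Candidate-transfer (remove a j) a λ _ _ → ∈ᶜ-remove⁻ a)
    u≢rank-b : toℕ u ≢ rank (remove a j)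
    u≢rank-b u≡rank = contradiction (trans (sym notUpper-b) (isUpper⁺ (remove a j) pivot-b u∈b)) λ ()
      where
      pivot-b : pivot (remove a j) ≡ just u
      pivot-b = rankOf-injective (pivot (remove a j)) (sym u≡rank)

  pairKey-increases : ∀ a {i j} → a ∈ taylorCells l → anchor a ≡ just i → anchor (remove a j) ≡ just i →
                      j ∈ᶜ a → ¬ MatchedEdge K pivotMatching a (remove a j) →
                      pairKey a <ₚ pairKey (remove a j)
  pairKey-increases a {j = j} a∈ anchor-a anchor-b j∈a unmatched with upper-or-not a
  ... | inj₂ notUpper-a =
    inj₁ (ℕP.≤-<-trans (pairKey₁≤size (remove a j))
                       (subst (size (remove a j) ℕ.<_) (sym (cong proj₁ (pairKey-notUpper a notUpper-a)))
                              (size-remove-< a j∈a)))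
  ... | inj₁ (u , pivot-a , u∈a) with j Fin.≟ u
  ...   | no j≢u   = removed-from-upper-increases a anchor-a anchor-b j∈a j≢u pivot-a u∈a
  ...   | yes refl with removePivot-lower a a∈ pivot-a u∈a
  ...     | a∖u∈ , upper≡a =
    contradiction (subst (λ X → MatchedEdge K pivotMatching X (remove a j)) upper≡a (matchedEdge⁺ a∖u∈))
                  unmatched

  down-edge-increases : ∀ a {j} → a ∈ taylorCells l → remove a j ∈ taylorCells l → j ∈ᶜ a →
                        ¬ MatchedEdge K pivotMatching a (remove a j) → key a ⊏ key (remove a j)
  down-edge-increases a {j} a∈ b∈ j∈a unmatched
    with IsLeast-exists a (∈-taylorCells⇒NonEmpty a∈)
       | IsLeast-exists (remove a j) (∈-taylorCells⇒NonEmpty b∈)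
  ... | i , i-least | i′ , i′-least with j Fin.≟ i
  ...   | yes refl =
    inj₁ (subst₂ _<₋_ (sym (anchor-complete a i-least)) (sym (anchor-complete (remove a j) i′-least))
                      [ IsLeast-remove-least a i-least i′-least ])
  ...   | no j≢i =
    inj₂ (trans anchor-a (sym anchor-b) , pairKey-increases a a∈ anchor-a anchor-b j∈a unmatched)
    where
    anchor-a : anchor a ≡ just i
    anchor-a = anchor-complete a i-least
    anchor-b : anchor (remove a j) ≡ just i
    anchor-b = anchor-complete (remove a j) (IsLeast-remove a j≢i i-least)

  edge-increases : ∀ {x y} → EdgeM K (taylor K g) pivotMatching x y → key x ⊏ key y
  edge-increases {x} (x∈ , y∈ , inj₁ (D≉0 , unmatched)) with taylorD-support x _ D≉0
  ... | j , j∈x , refl = down-edge-increases x x∈ y∈ j∈x unmatched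
  edge-increases (_ , _ , inj₂ matched) with matchedEdge⁻ lowerCells matched
  ... | I , I∈ , refl , refl = up-edge-increases I∈

  pivotMatching-acyclic : IsAcyclicMatching K (taylor K g) pivotMatching
  pivotMatching-acyclic = pivotMatching-units , pivotMatching-unique ,
                          acyclic-if-key-increasing ⊏-isStrictPartialOrder key edge-increases

  module _ (minGen : IsMinGen g)
           (gcdCondition : ∀ m k → m ≺ k → gcdₘ (g m) (g k) ≡ oneₘ →
                           ∃[ u ] (u ≢ m × u ≢ k × m ≺ u × g u ∣ₘ lcmₘ (g m) (g k))) where

    unmatched-linked-to-least : ∀ I {i j} → I ∈ taylorCells l → I ∉ endpoints K pivotMatching →
                                IsLeast I i → j ∈ᶜ I → j ≡ i ⊎ gcdₘ (g j) (g i) ≢ oneₘ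
    unmatched-linked-to-least I {i} {j} I∈ unmatched i-least j∈I
      with j Fin.≟ i | gcdₘ (g j) (g i) ≟ₘ oneₘ
    ... | yes j≡i | _           = inj₁ j≡i
    ... | no _    | no linked   = inj₂ linked
    ... | no j≢i  | yes coprime with proj₂ i-least j j∈I
    ...   | inj₂ refl = contradiction refl j≢i
    ...   | inj₁ i≺j with gcdCondition i j i≺j (trans (gcdₘ-comm (g i) (g j)) coprime)
    ...     | u , _ , u≢j , i≺u , u∣ =
      contradiction (pivot⇒matched I I∈ (proj₂ (pivot-exists I (anchor-complete I i-least) candidate)))
                    unmatched
      where
      candidate : Candidate I i u
      candidate = i≺u , (λ u-coprime → u≢j (minGen u j (coprime-∣-lcmₘ (g u) (g i) (g j) u-coprime u∣)))
                , j , j∈I , coprime , u∣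

    unmatched⇒ClOne : ∀ I → I ∈ taylorCells l → I ∉ endpoints K pivotMatching → ClOne g I
    unmatched⇒ClOne I I∈ unmatched with IsLeast-exists I (∈-taylorCells⇒NonEmpty I∈)
    ... | i , i-least = ∈-taylorCells⇒NonEmpty I∈ , λ j k j∈I k∈I → toLeast j∈I ◅◅ fromLeast k∈I
      where
      toLeast : ∀ {j} → j ∈ᶜ I → Star (GcdRel g I) j i
      toLeast j∈I with unmatched-linked-to-least I I∈ unmatched i-least j∈I
      ... | inj₁ refl   = ε
      ... | inj₂ linked = (j∈I , proj₁ i-least , linked) ◅ ε
      fromLeast : ∀ {k} → k ∈ᶜ I → Star (GcdRel g I) i k
      fromLeast {k} k∈I with unmatched-linked-to-least I I∈ unmatched i-least k∈I
      ... | inj₁ refl   = ε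
      ... | inj₂ linked = (proj₁ i-least , k∈I , linked ∘ trans (gcdₘ-comm (g k) (g i))) ◅ ε

proposition3p11 : ∀ {c ℓ : Level} (K : Field c ℓ) (n l : ℕ) (g : Fin l → Mono n) →
    IsMinGen g → StrongGcd g →
    ∃[ B ] (MatchingSeq K (taylor K g) B × (∀ I → I ∈ Based.cells B → ClOne g I))
proposition3p11 K n l g minGen (_≺_ , ≺-sto , gcdCondition) =
  morse K (taylor K g) pivotMatching , step pivotMatching pivotMatching-acyclic done , critical-ClOne
  where
  open PivotMatching K g ≺-sto
  critical-ClOne : ∀ I → I ∈ cells (morse K (taylor K g) pivotMatching) → ClOne g I
  critical-ClOne I I∈ = let I∈T , unmatched = ∈-morse⁻ K (taylor K g) pivotMatching I∈
                        in unmatched⇒ClOne minGen gcdCondition I I∈T unmatched
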